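{- Let $\Pi$ be a GSP of an SF instance $I=(A,\succ,c)$ containing cyclic permutations $\Pi_r,\Pi_s$. Then for all distinct $a_i,a_j\in A$, if $\Pi_r^{ -1}(a_j)=a_i$ and $\Pi_s^{ -1}(a_j)=a_i$, then $\Pi_r=\Pi_s$.
   Context: A Stable Fixtures (SF) instance is $I=(A,\succ,c)$ where $A=\{a_1,\dots,a_n\}$ is a finite set of $n$ agents; each agent $a_i$ has a strict linear order $\succ_i$ over $A\setminus\{a_i\}$ (complete preference list), with the convention that every agent ranks itself last ($a_j\succ_i a_i$ for all $j\neq i$); $a\succeq_i b$ means $a\succ_i b$ or $a=b$. Each agent has an integer capacity $c_i$ with $1\le c_i<n$. A cyclic permutation of a nonempty set $A_r\subseteq A$ is a permutation $\Pi_r$ of $A_r$ consisting of a single cycle of length $|A_r|$ (length 1: a fixed point $(a_i)$; length 2: a transposition $(a_i\ a_j)$). Two cyclic permutations are distinct if some element is mapped to different elements by them. A GSP (generalised stable partition) of $I$ is a finite collection $\Pi=\{\Pi_1,\dots,\Pi_k\}$ of cyclic permutations $\Pi_r$ of sets $A_r\subseteq A$, pairwise distinct except that fixed points may be repeated, such that: (F1) for every $r$ and every $a_j\in A_r$, $\Pi_r(a_j)\succeq_j\Pi_r^{ -1}(a_j)$; (F2) there are no distinct $a_i,a_j\in A$ with the transposition $(a_i\ a_j)\notin\Pi$ such that $a_j\succ_i\Pi_r^{ -1}(a_i)$ and $a_i\succ_j\Pi_s^{ -1}(a_j)$ for some $\Pi_r,\Pi_s\in\Pi$ with $a_i\in A_r$,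 $a_j\in A_s$; (F3) for every $a_i\in A$, the number of indices $r$ with $a_i\in A_r$ equals $c_i$; (F4) for all distinct $a_i,a_j\in A$, $|\{s:\Pi_s(a_i)=a_j\}|+|\{s:\Pi_s(a_j)=a_i\}|\le 2$. -}

module Defs where

open import Data.Nat using (ℕ; zero; suc; _+_; _<_; _≤_)
open import Data.Bool using (Bool; true; false; if_then_else_)
open import Data.Fin using (Fin; zero; suc)
open import Data.Fin.Subset using (Subset; _∈_; Nonempty)
open import Data.Fin.Subset.Properties using (_∈?_)
open import Data.Product using (Σ; ∃; _×_; _,_)
open import Data.Sum using (_⊎_)
open import Relation.Nullary using (¬_; Dec; does)
open import Relation.Nullary.Decidable using (_×-dec_)
open import Relation.Binary.PropositionalEquality using (_≡_; _≢_)
open import Function.Bundles using (_⇔_)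
import Data.Fin as F

iter : ∀ {A : Set} → (A → A) → ℕ → A → A
iter f zero    x = x
iter f (suc k) x = f (iter f k x)

countB : ∀ {k} → (Fin k → Bool) → ℕ
countB {zero}  b = 0
countB {suc k} b = (if b zero then 1 else 0) + countB (λ r → b (suc r))

-- Preferences of agent i: a rank function  rank i : Fin n → ℕ, injective
-- (so a strict linear order), with i ranked strictly last.
-- a ≻_i b  iff  rank i a < rank i b.

record SF (n : ℕ) : Set where
  field
    rank     : Fin n → Fin n → ℕ
    rank-inj : ∀ i a b → rank i a ≡ rank i b → a ≡ b
    self-last : ∀ i j → j ≢ i → rank i j < rank i i
    cap      : Fin n → ℕ
    cap-pos  : ∀ i → 1 ≤ cap i
    cap-lt   : ∀ i → cap i < n

  _≻[_]_ : Fin n → Fin n → Fin n → Set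
  a ≻[ i ] b = rank i a < rank i b

  _⪰[_]_ : Fin n → Fin n → Fin n → Set
  a ⪰[ i ] b = (a ≻[ i ] b) ⊎ (a ≡ b)

-- A cyclic permutation of a nonempty set A_r ⊆ A:
-- the set (support), the map Π_r (fwd) and its inverse Π_r⁻¹ (bwd),
-- both only meaningful on the support; Π_r consists of a single cycle
-- on the support.

record CycPerm (n : ℕ) : Set where
  field
    support     : Subset n
    nonempty    : Nonempty support
    fwd         : Fin n → Fin n
    bwd         : Fin n → Fin n
    fwd-closed  : ∀ x → x ∈ support → fwd x ∈ support
    bwd-closed  : ∀ x → x ∈ support → bwd x ∈ support
    bwd-fwd     : ∀ x → x ∈ support → bwd (fwd x) ≡ x
    fwd-bwd     : ∀ x → x ∈ support → fwd (bwd x) ≡ x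
    single-cycle : ∀ x y → x ∈ support → y ∈ support → ∃ λ k → iter fwd k x ≡ y

open CycPerm public

SameCyc : ∀ {n} → CycPerm n → CycPerm n → Set
SameCyc P Q = (support P ≡ support Q) × (∀ x → x ∈ support P → fwd P x ≡ fwd Q x)

IsFixedPoint : ∀ {n} → CycPerm n → Set
IsFixedPoint P = ∃ λ a → ∀ x → (x ∈ support P) ⇔ (x ≡ a)

IsTransposition : ∀ {n} → CycPerm n → Fin n → Fin n → Set
IsTransposition P a b =
  (∀ x → (x ∈ support P) ⇔ ((x ≡ a) ⊎ (x ≡ b))) × (fwd P a ≡ b) × (fwd P b ≡ a)

-- A GSP: a finite collection Π = {Π_1,…,Π_k}, indexed by Fin k.

module _ {n : ℕ} (I : SF n) where
  open SF I

  memCount : ∀ {k} → (Fin k → CycPerm n) → Fin n → ℕ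
  memCount Π i = countB (λ r → does (i ∈? support (Π r)))

  mapCount : ∀ {k} → (Fin k → CycPerm n) → Fin n → Fin n → ℕ
  mapCount Π i j = countB (λ s → does ((i ∈? support (Π s)) ×-dec (fwd (Π s) i F.≟ j)))

  record IsGSP {k : ℕ} (Π : Fin k → CycPerm n) : Set where
    field
      distinct : ∀ r s → r ≢ s → SameCyc (Π r) (Π s) → IsFixedPoint (Π r)
      F1 : ∀ r j → j ∈ support (Π r) → fwd (Π r) j ⪰[ j ] bwd (Π r) j
      F2 : ∀ i j → i ≢ j → ¬ (∃ λ t → IsTransposition (Π t) i j) →
           ∀ r s → i ∈ support (Π r) → j ∈ support (Π s) →
           ¬ ((j ≻[ i ] bwd (Π r) i) × (i ≻[ j ] bwd (Π s) j))
      F3 : ∀ i → memCount Π i ≡ cap i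
      F4 : ∀ i j → i ≢ j → mapCount Π i j + mapCount Π j i ≤ 2

-- Say that two cycles agree at x if x lies on both and has the same successor
-- on both. For distinct cycles Π_r, Π_s of a GSP, agreement at a forces the
-- predecessors of a to coincide: if a preferred its predecessor p' on Π_s to
-- its predecessor on Π_r, then (a, p') would be a blocking pair for (F2), the
-- only escapes being a transposition (a p') in Π or a = Π_s⁻¹(p'), and both
-- produce three arcs between a and p', against (F4). The hypothesis makes Π_r
-- and Π_s agree at a_i, so walking backwards along each single cycle shows
-- that they agree everywhere.
module Submission where

open import Defs
open import Data.Nat using (ℕ; zero; suc; _≤_; s≤s; z≤n)
open import Data.Nat.Properties using (m≤n+m; +-mono-≤; <-cmp; <-irrefl; <-asym; ≤-trans)
open import Data.Bool using (Bool; true; false)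
open import Data.Fin using (Fin; zero; suc; _≟_)
open import Data.Fin.Subset using (_∈_)
open import Data.Fin.Subset.Properties using (_∈?_; ⊆-antisym)
open import Data.Product using (∃; _×_; _,_; proj₁; proj₂)
open import Data.Sum using (inj₁; inj₂)
open import Data.Empty using (⊥; ⊥-elim)
open import Function.Base using (case_of_)
open import Function.Bundles using (Equivalence)
open import Relation.Nullary using (¬_; yes; no; does)
open import Relation.Nullary.Decidable using (dec-true; _×-dec_)
open import Relation.Binary using (tri<; tri≈; tri>)
open import Relation.Binary.PropositionalEquality

countB-tail≤ : ∀ {k} (b : Fin (suc k) → Bool) → countB (λ r → b (suc r)) ≤ countB b
countB-tail≤ b with b zero
... | true  = m≤n+m _ 1
... | false = m≤n+m _ 0

1≤countB : ∀ {k} (b : Fin k → Bool) u → b u ≡ true → 1 ≤ countB b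
1≤countB b zero    bu with b zero
1≤countB b zero    refl | true = s≤s z≤n
1≤countB b (suc u) bu = ≤-trans (1≤countB (λ r → b (suc r)) u bu) (countB-tail≤ b)

2≤countB : ∀ {k} (b : Fin k → Bool) u v → u ≢ v → b u ≡ true → b v ≡ true → 2 ≤ countB b
2≤countB b zero    zero    u≢v _  _  = ⊥-elim (u≢v refl)
2≤countB b zero    (suc v) _   bu bv with b zero
2≤countB b zero    (suc v) _   refl bv | true = s≤s (1≤countB (λ r → b (suc r)) v bv)
2≤countB b (suc u) zero    _   bu bv with b zero
2≤countB b (suc u) zero    _   bu refl | true = s≤s (1≤countB (λ r → b (suc r)) u bu)
2≤countB b (suc u) (suc v) u≢v bu bv =
  ≤-trans (2≤countB (λ r → b (suc r)) u v (λ e → u≢v (cong suc e)) bu bv) (countB-tail≤ b)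

iter-suc : ∀ {A : Set} (f : A → A) k x → iter f (suc k) x ≡ iter f k (f x)
iter-suc f zero    x = refl
iter-suc f (suc k) x = cong f (iter-suc f k x)

module _ {n : ℕ} (P : CycPerm n) (Q : Fin n → Set)
         (Q-bwd : ∀ x → x ∈ support P → Q x → Q (bwd P x)) where

  iter-back : ∀ m x → x ∈ support P → Q (iter (fwd P) m x) → Q x
  iter-back zero    x x∈P Qx = Qx
  iter-back (suc m) x x∈P Qfx =
    subst Q (bwd-fwd P x x∈P)
      (Q-bwd (fwd P x) (fwd-closed P x x∈P)
        (iter-back m (fwd P x) (fwd-closed P x x∈P) (subst Q (iter-suc (fwd P) m x) Qfx)))

  cycle-induction-bwd : ∀ {i} → i ∈ support P → Q i → ∀ x → x ∈ support P → Q x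
  cycle-induction-bwd i∈P Qi x x∈P with single-cycle P x _ x∈P i∈P
  ... | m , iterₘx≡i = iter-back m x x∈P (subst Q (sym iterₘx≡i) Qi)

Agree : ∀ {n} → CycPerm n → CycPerm n → Fin n → Set
Agree P Q x = (x ∈ support P) × (x ∈ support Q) × (fwd P x ≡ fwd Q x)

Agree-sym : ∀ {n} (P Q : CycPerm n) {x} → Agree P Q x → Agree Q P x
Agree-sym _ _ (x∈P , x∈Q , e) = x∈Q , x∈P , sym e

Agree-bwd : ∀ {n} (P Q : CycPerm n) {x} → Agree P Q x → bwd P x ≡ bwd Q x →
            Agree P Q (bwd P x)
Agree-bwd P Q {x} (x∈P , x∈Q , _) bP≡bQ =
  bwd-closed P x x∈P ,
  subst (_∈ support Q) (sym bP≡bQ) (bwd-closed Q x x∈Q) ,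
  (begin
    fwd P (bwd P x) ≡⟨ fwd-bwd P x x∈P ⟩
    x               ≡⟨ fwd-bwd Q x x∈Q ⟨
    fwd Q (bwd Q x) ≡⟨ cong (fwd Q) bP≡bQ ⟨
    fwd Q (bwd P x) ∎)
  where open ≡-Reasoning

sameCyc-if-agreement-propagates :
  ∀ {n} (P Q : CycPerm n) →
  (∀ {x} → Agree P Q x → bwd P x ≡ bwd Q x) →
  ∀ {i} → Agree P Q i → SameCyc P Q
sameCyc-if-agreement-propagates P Q propagates {i} agreeᵢ =
  ⊆-antisym (λ {x} x∈P → proj₁ (proj₂ (agreeP x x∈P)))
            (λ {x} x∈Q → proj₁ (proj₂ (agreeQ x x∈Q))) ,
  λ x x∈P → proj₂ (proj₂ (agreeP x x∈P))
  where
    agreeP : ∀ x → x ∈ support P → Agree P Q x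
    agreeP = cycle-induction-bwd P (Agree P Q)
      (λ x _ a → Agree-bwd P Q a (propagates a)) (proj₁ agreeᵢ) agreeᵢ

    agreeQ : ∀ x → x ∈ support Q → Agree Q P x
    agreeQ = cycle-induction-bwd Q (Agree Q P)
      (λ x _ a → Agree-bwd Q P a (sym (propagates (Agree-sym Q P a))))
      (proj₁ (proj₂ agreeᵢ)) (Agree-sym P Q agreeᵢ)

module _ {n : ℕ} (I : SF n) where
  open SF I

  ¬self≻ : ∀ a b → ¬ (a ≻[ a ] b)
  ¬self≻ a b a≻b with b ≟ a
  ... | yes refl = <-irrefl refl a≻b
  ... | no  b≢a  = <-asym a≻b (self-last a b b≢a)

  module _ {k : ℕ} (Π : Fin k → CycPerm n) (G : IsGSP I Π) where
    open IsGSP G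

    Arc : Fin k → Fin n → Fin n → Set
    Arc u x y = (x ∈ support (Π u)) × (fwd (Π u) x ≡ y)

    Arc⇒counted : ∀ {u x y} → Arc u x y →
                  does ((x ∈? support (Π u)) ×-dec (fwd (Π u) x ≟ y)) ≡ true
    Arc⇒counted {u} {x} {y} = dec-true ((x ∈? support (Π u)) ×-dec (fwd (Π u) x ≟ y))

    ¬double-arc-and-reverse : ∀ {x y u v w} → x ≢ y → u ≢ v →
                              Arc u x y → Arc v x y → Arc w y x → ⊥
    ¬double-arc-and-reverse {x} {y} {u} {v} {w} x≢y u≢v uxy vxy wyx
      with ≤-trans (+-mono-≤ (2≤countB _ u v u≢v (Arc⇒counted uxy) (Arc⇒counted vxy))
                             (1≤countB _ w (Arc⇒counted wyx)))
                   (F4 x y x≢y)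
    ... | s≤s (s≤s ())

    ¬preferred-predecessor : ∀ {r s a} → r ≢ s → Agree (Π r) (Π s) a →
                             ¬ (bwd (Π s) a ≻[ a ] bwd (Π r) a)
    ¬preferred-predecessor {r} {s} {a} r≢s (a∈r , a∈s , same-succ) p′≻p =
      case F1 s p′ p′∈s of λ where
        (inj₂ a≡bwd-p′) → ¬a↦p′
          (trans (cong (fwd (Π s)) (trans (sym (proj₂ p′↦a)) a≡bwd-p′)) (fwd-bwd (Π s) p′ p′∈s))
        (inj₁ a≻bwd-p′) → F2 a p′ a≢p′ ¬transposition r s a∈r p′∈s
          (p′≻p , subst (_≻[ p′ ] bwd (Π s) p′) (proj₂ p′↦a) a≻bwd-p′)
      where
        p′ = bwd (Π s) a
        p′∈s = bwd-closed (Π s) a a∈s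

        p′↦a : Arc s p′ a
        p′↦a = p′∈s , fwd-bwd (Π s) a a∈s

        a≢p′ : a ≢ p′
        a≢p′ a≡p′ = ¬self≻ a (bwd (Π r) a) (subst (_≻[ a ] bwd (Π r) a) (sym a≡p′) p′≻p)

        ¬a↦p′ : fwd (Π s) a ≢ p′
        ¬a↦p′ e = ¬double-arc-and-reverse a≢p′ r≢s (a∈r , trans same-succ e) (a∈s , e) p′↦a

        ¬transposition : ¬ (∃ λ t → IsTransposition (Π t) a p′)
        ¬transposition (t , t-support , a↦p′ , p′↦a′) with t ≟ s
        ... | yes refl = ¬a↦p′ a↦p′
        ... | no  t≢s  = ¬double-arc-and-reverse (λ e → a≢p′ (sym e)) t≢s
              (Equivalence.from (t-support p′) (inj₂ refl) , p′↦a′) p′↦a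
              (Equivalence.from (t-support a) (inj₁ refl) , a↦p′)

    common-successor⇒common-predecessor : ∀ {r s a} → r ≢ s → Agree (Π r) (Π s) a →
                                          bwd (Π r) a ≡ bwd (Π s) a
    common-successor⇒common-predecessor {r} {s} {a} r≢s agree
      with <-cmp (rank a (bwd (Π r) a)) (rank a (bwd (Π s) a))
    ... | tri< p≻p′ _ _ = ⊥-elim (¬preferred-predecessor (λ e → r≢s (sym e)) (Agree-sym (Π r) (Π s) agree) p≻p′)
    ... | tri≈ _ same _ = rank-inj a _ _ same
    ... | tri> _ _ p′≻p = ⊥-elim (¬preferred-predecessor r≢s agree p′≻p)

Agree-at-common-predecessor : ∀ {n} (P Q : CycPerm n) {i j} →
                              j ∈ support P → bwd P j ≡ i →
                              j ∈ support Q → bwd Q j ≡ i →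
                              Agree P Q i
Agree-at-common-predecessor P Q {i} {j} j∈P refl j∈Q bQj≡i =
  bwd-closed P j j∈P ,
  subst (_∈ support Q) bQj≡i (bwd-closed Q j j∈Q) ,
  (begin
    fwd P (bwd P j) ≡⟨ fwd-bwd P j j∈P ⟩
    j               ≡⟨ fwd-bwd Q j j∈Q ⟨
    fwd Q (bwd Q j) ≡⟨ cong (fwd Q) bQj≡i ⟩
    fwd Q (bwd P j) ∎)
  where open ≡-Reasoning

lemma1 : ∀ {n : ℕ} (I : SF n) {k : ℕ} (Π : Fin k → CycPerm n) → IsGSP I Π →
         ∀ (r s : Fin k) (i j : Fin n) → i ≢ j →
         j ∈ support (Π r) → bwd (Π r) j ≡ i →
         j ∈ support (Π s) → bwd (Π s) j ≡ i →
         SameCyc (Π r) (Π s)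
lemma1 I Π G r s i j _ j∈r r⁻¹j≡i j∈s s⁻¹j≡i with r ≟ s
... | yes refl = refl , λ _ _ → refl
... | no  r≢s  =
  sameCyc-if-agreement-propagates (Π r) (Π s)
    (common-successor⇒common-predecessor I Π G r≢s)
    (Agree-at-common-predecessor (Π r) (Π s) j∈r r⁻¹j≡i j∈s s⁻¹j≡i)
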